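{- Let $G$ be a connected graph with $n$ vertices and matching number $k$, where $2\le k<\lfloor n/2\rfloor$. Then $\sigma_0(G)\ge 2-\frac kn$ and $\sigma_1(G)\ge 4n-3k$. In each bound, equality holds if and only if $G=K_k\vee\overline{K}_{n-k}$.
   Context: Graphs are finite, simple and undirected. The matching number is the maximum size of a set of pairwise disjoint edges. For a connected graph $G$ and vertex $u$, $\varepsilon_G(u)=\max_{v\in V(G)}d_G(u,v)$; $\sigma_0(G)=\frac1{|V(G)|}\sum_u\varepsilon_G(u)$ and $\sigma_1(G)=\sum_u\varepsilon_G(u)^2$. $K_m$ is the complete graph and $\overline{K}_m$ the edgeless graph on $m$ vertices; $G\vee H$ (join) is the disjoint union of $G$ and $H$ together with all edges between $V(G)$ and $V(H)$. -}

module Defs where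

open import Data.Nat using (ℕ; zero; suc; _+_; _*_; _⊔_; _≤_; NonZero)
open import Data.Bool using (Bool; true; false; _∧_; _∨_; if_then_else_; not)
open import Data.Fin using (Fin; toℕ; _≟_)
open import Data.List using (List; []; _∷_; map; foldr; allFin; length; concatMap)
open import Data.Nat.ListAction using (sum)
open import Data.List.Relation.Unary.All using (All)
open import Data.List.Relation.Unary.Unique.Propositional using (Unique)
open import Data.Product using (Σ; _×_; _,_)
open import Data.Integer using (+_)
open import Data.Rational using (ℚ; 0ℚ; _/_)
open import Relation.Binary.PropositionalEquality using (_≡_)
open import Relation.Nullary.Decidable using (⌊_⌋)
open import Function.Bundles using (_↔_; Inverse)

record Graph (n : ℕ) : Set where
  field
    adj   : Fin n → Fin n → Bool
    sym   : ∀ u v → adj u v ≡ adj v u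
    irrefl : ∀ u → adj u u ≡ false
open Graph public

reach : ∀ {n} → Graph n → ℕ → Fin n → Fin n → Bool
reach G zero    u v = ⌊ u ≟ v ⌋
reach G (suc l) u v = reach G l u v ∨ foldr _∨_ false (map (λ w → reach G l u w ∧ adj G w v) (allFin _))

Connected : ∀ {n} → Graph n → Set
Connected G = ∀ u v → Σ ℕ (λ l → reach G l u v ≡ true)

-- distance: least l (searched with fuel) such that v is reachable from u within l steps.
-- For a connected graph on n vertices the distance is < n, so fuel n suffices.
distFrom : ∀ {n} → Graph n → Fin n → Fin n → ℕ → ℕ → ℕ
distFrom G u v l zero       = l
distFrom G u v l (suc fuel) = if reach G l u v then l else distFrom G u v (suc l) fuel

dist : ∀ {n} → Graph n → Fin n → Fin n → ℕ
dist {n} G u v = distFrom G u v 0 n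

ecc : ∀ {n} → Graph n → Fin n → ℕ
ecc {n} G u = foldr _⊔_ 0 (map (dist G u) (allFin n))

σ₀ : ∀ {n} → Graph n → ℚ
σ₀ {zero}  G = 0ℚ
σ₀ {suc m} G = + sum (map (ecc G) (allFin (suc m))) / suc m

σ₁ : ∀ {n} → Graph n → ℕ
σ₁ {n} G = sum (map (λ u → ecc G u * ecc G u) (allFin n))

endpoints : ∀ {n} → List (Fin n × Fin n) → List (Fin n)
endpoints = concatMap (λ { (a , b) → a ∷ b ∷ [] })

IsMatching : ∀ {n} → Graph n → List (Fin n × Fin n) → Set
IsMatching G M = All (λ { (a , b) → adj G a b ≡ true }) M × Unique (endpoints M)

MatchingNumber : ∀ {n} → Graph n → ℕ → Set
MatchingNumber G k =
  Σ (List _) (λ M → IsMatching G M × length M ≡ k)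
  × (∀ M → IsMatching G M → length M ≤ k)

-- K_k ∨ \bar K_{n-k} on Fin n: vertices with index < k form the clique,
-- distinct i, j adjacent iff at least one of them lies in the clique.
splitAdj : ∀ {n} → ℕ → Fin n → Fin n → Bool
splitAdj k i j = not ⌊ i ≟ j ⌋ ∧ (⌊ Data.Nat._<?_ (toℕ i) k ⌋ ∨ ⌊ Data.Nat._<?_ (toℕ j) k ⌋)

IsoSplit : ∀ {n} → Graph n → ℕ → Set
IsoSplit {n} G k = Σ (Fin n ↔ Fin n) (λ π →
  ∀ i j → adj G (Inverse.to π i) (Inverse.to π j) ≡ splitAdj k i j)

-- the rational number 2 - k/n  (n = 0 never occurs in the theorem; value irrelevant there)
twoMinus : ℕ → ℕ → ℚ
twoMinus zero    k = 0ℚ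
twoMinus (suc m) k = Data.Rational._-_ (Data.Rational._+_ Data.Rational.1ℚ Data.Rational.1ℚ) (+ k / suc m)

-- Call a vertex universal if it is adjacent to every other vertex, and let t be the number of
-- universal vertices. A universal vertex has eccentricity 1 and any other vertex eccentricity
-- at least 2, so the sum of eccentricities is at least t + 2(n - t) = 2n - t and the sum of
-- their squares at least t + 4(n - t) = 4n - 3t. Since n ≥ 2k + 2, any k + 1 universal vertices
-- could be matched to distinct partners, so t ≤ k, which gives both bounds. Equality forces t = k.
-- Then every eccentricity is at most 2 (through a universal vertex) and the non-universal
-- vertices are pairwise non-adjacent (an edge among them would extend a matching of the k
-- universal vertices to one of size k + 1), which says exactly that G ≅ K_k ∨ K̄_{n-k}.
-- Conversely, the clique of K_k ∨ K̄_{n-k} consists of k universal vertices.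
module Submission where

open import Defs renaming (sym to adj-sym)
open import Data.Bool using (Bool; true; false; _∧_; _∨_)
import Data.Bool as Bool
open import Data.Bool.ListAction using (any)
open import Data.Bool.Properties using (∨-zeroʳ; ¬-not)
open import Data.Empty using (⊥-elim)
open import Data.Fin using (Fin; toℕ; _≟_; cast; inject≤; fromℕ<) renaming (zero to fzero; suc to fsuc)
open import Data.Fin.Properties
  using (all?; ¬∀⟶∃¬; toℕ-cast; toℕ-injective; cast-involutive; injective⇒≤;
         inject≤-injective; toℕ-inject≤; toℕ<n)
open import Data.Integer using (+_)
import Data.Integer as ℤ
import Data.Integer.Properties as ℤ
open import Data.Integer.Tactic.RingSolver using () renaming (solve-∀ to solve-∀ℤ)
open import Data.List using (List; []; _∷_; map; foldr; allFin; length; filter; take; drop; zip; _++_; lookup)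
open import Data.List.Properties using (length-++; length-zipWith; length-take; length-drop; length-tabulate; filter-all)
open import Data.List.Membership.Propositional using (_∈_; _∉_)
open import Data.List.Membership.Propositional.Properties
  using (∈-allFin; ∈-filter⁺; ∈-filter⁻; ∈-++⁺ˡ; ∈-++⁺ʳ; ∈-lookup)
open import Data.List.Relation.Binary.Disjoint.Propositional using (Disjoint)
open import Data.List.Relation.Unary.All as All using (All; []; _∷_)
open import Data.List.Relation.Unary.All.Properties using (¬Any⇒All¬)
open import Data.List.Relation.Unary.Any using (here; there; index)
open import Data.List.Relation.Unary.Any.Properties using (lookup-index)
open import Data.List.Relation.Unary.AllPairs using ([]; _∷_)
open import Data.List.Relation.Unary.Unique.Propositional using (Unique)
open import Data.List.Relation.Unary.Unique.Propositional.Properties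
  using (++⁺; take⁺; drop⁺; filter⁺; allFin⁺)
open import Data.Nat using (ℕ; zero; suc; _+_; _*_; _∸_; _⊔_; _⊓_; _≤_; _<_; _/_; z≤n; s≤s; s≤s⁻¹; _≤?_; _<?_)
open import Data.Nat.DivMod using (m/n*n≤m)
open import Data.Nat.ListAction using (sum)
open import Data.Nat.Properties hiding (_≟_)
open import Data.Nat.Tactic.RingSolver using (solve-∀)
open import Data.Product using (∃; _×_; _,_; proj₁; proj₂)
import Data.Product as Product
open import Data.Rational using (ℚ; 1ℚ) renaming (_≤_ to _≤ℚ_)
import Data.Rational as ℚ
import Data.Rational.Properties as ℚ
open import Data.Rational.Unnormalised using (mkℚᵘ; *≡*; *≤*) renaming (_≃_ to _≃ᵘ_)
import Data.Rational.Unnormalised as ℚᵘ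
import Data.Rational.Unnormalised.Properties as ℚᵘ
open import Data.Sum using (_⊎_; inj₁; inj₂)
import Data.Sum as Sum
open import Function using (_∘_; id)
open import Function.Bundles using (_⇔_; mk⇔; _↔_; Inverse; mk↔ₛ′; Injection; Equivalence)
open import Function.Properties.Inverse using (↔⇒↣)
import Function.Properties.Equivalence as ⇔
open import Function.Definitions using (Injective)
open import Relation.Nullary using (¬_; yes; no; Dec; contradiction)
open import Relation.Nullary.Decidable using (¬?; _→-dec_)
open import Relation.Unary using (Pred; Decidable)
open import Relation.Binary.PropositionalEquality

count-suc-left : ∀ a b p q → a * suc p + b * q ≡ a + (a * p + b * q)
count-suc-left = solve-∀

count-suc-right : ∀ a b p q → a * p + b * suc q ≡ b + (a * p + b * q)
count-suc-right = solve-∀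

module _ {A : Set} where

  any-true : ∀ (f : A → Bool) {x xs} → x ∈ xs → f x ≡ true → any f xs ≡ true
  any-true f {xs = y ∷ xs} (here refl) fx≡true rewrite fx≡true = refl
  any-true f {xs = y ∷ xs} (there x∈xs) fx≡true rewrite any-true f x∈xs fx≡true = ∨-zeroʳ (f y)

  any-false : ∀ (f : A → Bool) xs → (∀ x → f x ≡ false) → any f xs ≡ false
  any-false f []       _     = refl
  any-false f (x ∷ xs) f≡false rewrite f≡false x = any-false f xs f≡false

  ≤-max : ∀ (f : A → ℕ) {x xs} → x ∈ xs → f x ≤ foldr _⊔_ 0 (map f xs)
  ≤-max f {xs = y ∷ xs} (here refl)  = m≤m⊔n (f y) _
  ≤-max f {xs = y ∷ xs} (there x∈xs) = ≤-trans (≤-max f x∈xs) (m≤n⊔m (f y) _)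

  max-≤ : ∀ (f : A → ℕ) xs {m} → (∀ x → f x ≤ m) → foldr _⊔_ 0 (map f xs) ≤ m
  max-≤ f []       _   = z≤n
  max-≤ f (x ∷ xs) f≤m = ⊔-lub (f≤m x) (max-≤ f xs f≤m)

  ∈-drop : ∀ m {x} {xs : List A} → x ∈ drop m xs → x ∈ xs
  ∈-drop zero                 x∈ = x∈
  ∈-drop (suc m) {xs = _ ∷ _} x∈ = there (∈-drop m x∈)

  ∈-take-++ : ∀ m {x} (xs ys : List A) → m ≤ length xs → x ∈ take m (xs ++ ys) → x ∈ xs
  ∈-take-++ (suc m) (y ∷ xs) ys (s≤s m≤) (here refl) = here refl
  ∈-take-++ (suc m) (y ∷ xs) ys (s≤s m≤) (there x∈) = there (∈-take-++ m xs ys m≤ x∈)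

  take-drop-disjoint : ∀ m {xs : List A} → Unique xs → Disjoint (take m xs) (drop m xs)
  take-drop-disjoint (suc m) {_ ∷ xs} (y∉xs ∷ _) (here refl , x∈) = All.lookup y∉xs (∈-drop m x∈) refl
  take-drop-disjoint (suc m) {_ ∷ _}  (_ ∷ xs!)  (there x∈ , x∈′) = take-drop-disjoint m xs! (x∈ , x∈′)

  lookup-injective : ∀ {xs : List A} → Unique xs → Injective _≡_ _≡_ (lookup xs)
  lookup-injective {_ ∷ _} _          {fzero}  {fzero}  _  = refl
  lookup-injective {_ ∷ _} (x∉xs ∷ _) {fzero}  {fsuc j} eq = ⊥-elim (All.lookup x∉xs (∈-lookup j) eq)
  lookup-injective {_ ∷ _} (x∉xs ∷ _) {fsuc i} {fzero}  eq = ⊥-elim (All.lookup x∉xs (∈-lookup i) (sym eq))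
  lookup-injective {_ ∷ _} (_ ∷ xs!)  {fsuc i} {fsuc j} eq = cong fsuc (lookup-injective xs! eq)

  lookup-∈-++ˡ : ∀ (xs ys : List A) i → toℕ i < length xs → lookup (xs ++ ys) i ∈ xs
  lookup-∈-++ˡ (x ∷ xs) ys fzero    _         = here refl
  lookup-∈-++ˡ (x ∷ xs) ys (fsuc i) (s≤s i<) = there (lookup-∈-++ˡ xs ys i i<)

  lookup-∈-++ʳ : ∀ (xs ys : List A) i → length xs ≤ toℕ i → lookup (xs ++ ys) i ∈ ys
  lookup-∈-++ʳ []       ys i        _         = ∈-lookup i
  lookup-∈-++ʳ (x ∷ xs) ys (fsuc i) (s≤s ≤i) = lookup-∈-++ʳ xs ys i ≤i

  injection-into-list-≤ : ∀ {k} {xs : List A} (f : Fin k → A) → Injective _≡_ _≡_ f → (∀ i → f i ∈ xs) → k ≤ length xs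
  injection-into-list-≤ {xs = xs} f f-inj f∈ = injective⇒≤ {f = index ∘ f∈} λ {i} {j} eq →
    f-inj (trans (lookup-index (f∈ i)) (trans (cong (lookup xs) eq) (sym (lookup-index (f∈ j)))))

  enumeration-↔ : ∀ {n} {xs : List A} → Unique xs → (∀ x → x ∈ xs) → length xs ≡ n → Fin n ↔ A
  enumeration-↔ {n} {xs} xs! complete len≡n = mk↔ₛ′ to from to∘from from∘to
    where
    to : Fin n → A
    to i = lookup xs (cast (sym len≡n) i)
    from : A → Fin n
    from x = cast len≡n (index (complete x))
    to-injective : Injective _≡_ _≡_ to
    to-injective eq = toℕ-injective (trans (sym (toℕ-cast _ _)) (trans (cong toℕ (lookup-injective xs! eq)) (toℕ-cast _ _)))
    to∘from : ∀ x → to (from x) ≡ x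
    to∘from x = trans (cong (lookup xs) (cast-involutive (sym len≡n) len≡n (index (complete x)))) (sym (lookup-index (complete x)))
    from∘to : ∀ i → from (to i) ≡ i
    from∘to i = to-injective (to∘from (to i))

  module _ {p} {P : Pred A p} (P? : Decidable P) where

    length-filter-partition : ∀ xs → length (filter P? xs) + length (filter (¬? ∘ P?) xs) ≡ length xs
    length-filter-partition []       = refl
    length-filter-partition (x ∷ xs) with P? x
    ... | yes _ = cong suc (length-filter-partition xs)
    ... | no  _ = trans (+-suc _ _) (cong suc (length-filter-partition xs))

    weighted-count-≤-sum : ∀ (g : A → ℕ) {a b} → (∀ x → P x → a ≤ g x) → (∀ x → ¬ P x → b ≤ g x) →
                           ∀ xs → a * length (filter P? xs) + b * length (filter (¬? ∘ P?) xs) ≤ sum (map g xs)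
    weighted-count-≤-sum g {a} {b} a≤ b≤ [] = ≤-reflexive (cong₂ _+_ (*-zeroʳ a) (*-zeroʳ b))
    weighted-count-≤-sum g {a} {b} a≤ b≤ (x ∷ xs) with P? x
    ... | yes px  = ≤-trans (≤-reflexive (count-suc-left a b _ _))
                            (+-mono-≤ (a≤ x px) (weighted-count-≤-sum g a≤ b≤ xs))
    ... | no  ¬px = ≤-trans (≤-reflexive (count-suc-right a b _ _))
                            (+-mono-≤ (b≤ x ¬px) (weighted-count-≤-sum g a≤ b≤ xs))

    weighted-count-≡-sum : ∀ (g : A → ℕ) {a b} → (∀ x → P x → g x ≡ a) → (∀ x → ¬ P x → g x ≡ b) →
                           ∀ xs → a * length (filter P? xs) + b * length (filter (¬? ∘ P?) xs) ≡ sum (map g xs)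
    weighted-count-≡-sum g {a} {b} ≡a ≡b [] = cong₂ _+_ (*-zeroʳ a) (*-zeroʳ b)
    weighted-count-≡-sum g {a} {b} ≡a ≡b (x ∷ xs) with P? x
    ... | yes px  = trans (count-suc-left a b _ _) (cong₂ _+_ (sym (≡a x px)) (weighted-count-≡-sum g ≡a ≡b xs))
    ... | no  ¬px = trans (count-suc-right a b _ _) (cong₂ _+_ (sym (≡b x ¬px)) (weighted-count-≡-sum g ≡a ≡b xs))

length-remove : ∀ {n} (x : Fin n) {xs : List (Fin n)} → Unique xs → length xs ≤ suc (length (filter (¬? ∘ (_≟ x)) xs))
length-remove x {[]}     _ = z≤n
length-remove x {y ∷ xs} (y∉xs ∷ xs!) with y ≟ x
... | yes refl = s≤s (≤-reflexive (cong length (sym (filter-all (¬? ∘ (_≟ x)) (All.map (λ y≢ ≡y → y≢ (sym ≡y)) y∉xs)))))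
... | no  _    = s≤s (length-remove x xs!)

∃-≢ : ∀ {n} → 2 ≤ n → (u : Fin n) → ∃ (u ≢_)
∃-≢ {suc zero}    (s≤s ()) _
∃-≢ {suc (suc _)} _ fzero    = fsuc fzero , λ ()
∃-≢ {suc (suc _)} _ (fsuc _) = fzero , λ ()

∈-endpoints-zip : ∀ {n} (A B : List (Fin n)) {x} → x ∈ endpoints (zip A B) → x ∈ A ⊎ x ∈ B
∈-endpoints-zip (a ∷ A) (b ∷ B) (here refl)         = inj₁ (here refl)
∈-endpoints-zip (a ∷ A) (b ∷ B) (there (here refl)) = inj₂ (here refl)
∈-endpoints-zip (a ∷ A) (b ∷ B) (there (there x∈))  = Sum.map there there (∈-endpoints-zip A B x∈)

splitAdj-clique : ∀ {n} k {i j : Fin n} → i ≢ j → toℕ i < k → splitAdj k i j ≡ true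
splitAdj-clique k {i} {j} i≢j i<k with i ≟ j | toℕ i <? k
... | yes i≡j | _       = contradiction i≡j i≢j
... | no  _   | yes _   = refl
... | no  _   | no  i≮k = contradiction i<k i≮k

module _ {n : ℕ} (G : Graph n) where

  reach-0-refl : ∀ u → reach G 0 u u ≡ true
  reach-0-refl u with u ≟ u
  ... | yes _   = refl
  ... | no  u≢u = contradiction refl u≢u

  reach-0-≢ : ∀ {u v} → u ≢ v → reach G 0 u v ≡ false
  reach-0-≢ {u} {v} u≢v with u ≟ v
  ... | yes u≡v = contradiction u≡v u≢v
  ... | no  _   = refl

  reach-suc : ∀ l {u v} → reach G l u v ≡ true → reach G (suc l) u v ≡ true
  reach-suc l uv rewrite uv = refl

  reach-step : ∀ l {u w v} → reach G l u w ≡ true → adj G w v ≡ true → reach G (suc l) u v ≡ true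
  reach-step l {u} {w} {v} uw wv =
    trans (cong (reach G l u v ∨_) (any-true _ (∈-allFin w) (cong₂ _∧_ uw wv))) (∨-zeroʳ _)

  reach-1-nonadjacent : ∀ {u v} → u ≢ v → adj G u v ≡ false → reach G 1 u v ≡ false
  reach-1-nonadjacent {u} {v} u≢v uv rewrite reach-0-≢ u≢v = any-false _ (allFin n) via
    where
    via : ∀ w → (reach G 0 u w ∧ adj G w v) ≡ false
    via w with u ≟ w
    ... | yes refl = uv
    ... | no  _    = refl

  distFrom-≤ : ∀ {u v} m l fuel → l ≤ m → m < l + fuel → reach G m u v ≡ true → distFrom G u v l fuel ≤ m
  distFrom-≤ m l zero l≤m m<l+0 _ = contradiction (≤-trans m<l+0 (≤-reflexive (+-identityʳ l))) (≤⇒≯ l≤m)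
  distFrom-≤ {u} {v} m l (suc fuel) l≤m m< reached with reach G l u v in eq
  ... | true  = l≤m
  ... | false with m≤n⇒m<n∨m≡n l≤m
  ...   | inj₁ l<m  = distFrom-≤ m (suc l) fuel l<m (≤-trans m< (≤-reflexive (+-suc l fuel))) reached
  ...   | inj₂ refl = contradiction (trans (sym eq) reached) λ ()

  distFrom-≥ : ∀ {u v} m l fuel → m ≤ l + fuel → (∀ i → i < m → reach G i u v ≡ false) → m ≤ distFrom G u v l fuel
  distFrom-≥ m l zero m≤l+0 _ = ≤-trans m≤l+0 (≤-reflexive (+-identityʳ l))
  distFrom-≥ {u} {v} m l (suc fuel) m≤ unreached with reach G l u v in eq
  ... | false = distFrom-≥ m (suc l) fuel (≤-trans m≤ (≤-reflexive (+-suc l fuel))) unreached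
  ... | true with m ≤? l
  ...   | yes m≤l = m≤l
  ...   | no  m≰l = contradiction (trans (sym eq) (unreached l (≰⇒> m≰l))) λ ()

  dist-≤ : ∀ {u v} m → m < n → reach G m u v ≡ true → dist G u v ≤ m
  dist-≤ m = distFrom-≤ m 0 n z≤n

  dist-≥2 : ∀ {u v} → 2 ≤ n → u ≢ v → adj G u v ≡ false → 2 ≤ dist G u v
  dist-≥2 {u} {v} 2≤n u≢v uv = distFrom-≥ 2 0 n 2≤n unreached
    where
    unreached : ∀ i → i < 2 → reach G i u v ≡ false
    unreached zero          _ = reach-0-≢ u≢v
    unreached (suc zero)    _ = reach-1-nonadjacent u≢v uv
    unreached (suc (suc _)) (s≤s (s≤s ()))

  dist-≥1 : ∀ {u v} → u ≢ v → 1 ≤ dist G u v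
  dist-≥1 {u} {v} u≢v = distFrom-≥ 1 0 n (≤-trans (s≤s z≤n) (toℕ<n u)) unreached
    where
    unreached : ∀ i → i < 1 → reach G i u v ≡ false
    unreached zero    _         = reach-0-≢ u≢v
    unreached (suc _) (s≤s ())

  Universal : Pred (Fin n) _
  Universal u = ∀ v → u ≢ v → adj G u v ≡ true

  adjacent-if-distinct? : ∀ u v → Dec (u ≢ v → adj G u v ≡ true)
  adjacent-if-distinct? u v = ¬? (u ≟ v) →-dec adj G u v Bool.≟ true

  universal? : Decidable Universal
  universal? u = all? (adjacent-if-distinct? u)

  nonuniversal⇒non-neighbour : ∀ {u} → ¬ Universal u → ∃ λ v → u ≢ v × adj G u v ≡ false
  nonuniversal⇒non-neighbour {u} ¬univ with ¬∀⟶∃¬ n _ (adjacent-if-distinct? u) ¬univ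
  ... | v , ¬[u≢v→uv] = v , (λ u≡v → ¬[u≢v→uv] λ u≢v → contradiction u≡v u≢v) , ¬-not (¬[u≢v→uv] ∘ λ uv _ → uv)

  reach-1-universal : ∀ {u} → Universal u → ∀ v → reach G 1 u v ≡ true
  reach-1-universal {u} univ v = by-cases (u ≟ v)
    where
    by-cases : Dec (u ≡ v) → reach G 1 u v ≡ true
    by-cases (yes refl) = reach-suc 0 (reach-0-refl u)
    by-cases (no  u≢v)  = reach-step 0 (reach-0-refl u) (univ v u≢v)

  reach-1-to-universal : ∀ {w} → Universal w → ∀ u → reach G 1 u w ≡ true
  reach-1-to-universal {w} univ u = by-cases (u ≟ w)
    where
    by-cases : Dec (u ≡ w) → reach G 1 u w ≡ true
    by-cases (yes refl) = reach-suc 0 (reach-0-refl u)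
    by-cases (no  u≢w)  = reach-step 0 (reach-0-refl u) (trans (adj-sym G u w) (univ u (u≢w ∘ sym)))

  reach-2-via-universal : ∀ {w} → Universal w → ∀ u v → reach G 2 u v ≡ true
  reach-2-via-universal {w} univ u v with w ≟ v
  ... | yes refl = reach-suc 1 (reach-1-to-universal univ u)
  ... | no  w≢v  = reach-step 1 (reach-1-to-universal univ u) (univ v w≢v)

  ecc-universal : 2 ≤ n → ∀ {u} → Universal u → ecc G u ≡ 1
  ecc-universal 2≤n {u} univ = ≤-antisym
    (max-≤ (dist G u) (allFin n) λ v → dist-≤ 1 2≤n (reach-1-universal univ v))
    (≤-trans (dist-≥1 (proj₂ (∃-≢ 2≤n u))) (≤-max (dist G u) (∈-allFin (proj₁ (∃-≢ 2≤n u)))))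

  ecc-nonuniversal-≥2 : 2 ≤ n → ∀ {u} → ¬ Universal u → 2 ≤ ecc G u
  ecc-nonuniversal-≥2 2≤n {u} ¬univ with nonuniversal⇒non-neighbour ¬univ
  ... | v , u≢v , uv = ≤-trans (dist-≥2 2≤n u≢v uv) (≤-max (dist G u) (∈-allFin v))

  ecc-≤2 : 3 ≤ n → ∀ {w} → Universal w → ∀ u → ecc G u ≤ 2
  ecc-≤2 3≤n univ u = max-≤ (dist G u) (allFin n) λ v → dist-≤ 2 3≤n (reach-2-via-universal univ u v)

  universals nonuniversals vertices : List (Fin n)
  universals    = filter universal? (allFin n)
  nonuniversals = filter (¬? ∘ universal?) (allFin n)
  vertices      = universals ++ nonuniversals

  ∈-universals⁻ : ∀ {u} → u ∈ universals → Universal u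
  ∈-universals⁻ u∈ = proj₂ (∈-filter⁻ universal? {xs = allFin n} u∈)

  ∈-nonuniversals⁻ : ∀ {u} → u ∈ nonuniversals → ¬ Universal u
  ∈-nonuniversals⁻ u∈ = proj₂ (∈-filter⁻ (¬? ∘ universal?) {xs = allFin n} u∈)

  ∈-vertices : ∀ u → u ∈ vertices
  ∈-vertices u with universal? u
  ... | yes univ  = ∈-++⁺ˡ (∈-filter⁺ universal? (∈-allFin u) univ)
  ... | no  ¬univ = ∈-++⁺ʳ universals (∈-filter⁺ (¬? ∘ universal?) (∈-allFin u) ¬univ)

  universals-unique : Unique universals
  universals-unique = filter⁺ universal? (allFin⁺ n)

  nonuniversals-unique : Unique nonuniversals
  nonuniversals-unique = filter⁺ (¬? ∘ universal?) (allFin⁺ n)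

  vertices-unique : Unique vertices
  vertices-unique = ++⁺ universals-unique nonuniversals-unique λ (u∈ , u∈′) → ∈-nonuniversals⁻ u∈′ (∈-universals⁻ u∈)

  length-universals+nonuniversals : length universals + length nonuniversals ≡ n
  length-universals+nonuniversals = trans (length-filter-partition universal? (allFin n)) (length-tabulate (λ u → u))

  length-vertices : length vertices ≡ n
  length-vertices = trans (length-++ universals) length-universals+nonuniversals

  sum-f∘ecc-≥ : 2 ≤ n → ∀ (f : ℕ → ℕ) → (∀ {a b} → a ≤ b → f a ≤ f b) →
                f 1 * length universals + f 2 * length nonuniversals ≤ sum (map (f ∘ ecc G) (allFin n))
  sum-f∘ecc-≥ 2≤n f f-mono = weighted-count-≤-sum universal? (f ∘ ecc G)
    (λ u univ → ≤-reflexive (cong f (sym (ecc-universal 2≤n univ))))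
    (λ u ¬univ → f-mono (ecc-nonuniversal-≥2 2≤n ¬univ))
    (allFin n)

  sum-f∘ecc-≡ : 3 ≤ n → ∀ {w} → Universal w → ∀ (f : ℕ → ℕ) →
                f 1 * length universals + f 2 * length nonuniversals ≡ sum (map (f ∘ ecc G) (allFin n))
  sum-f∘ecc-≡ 3≤n univ f = weighted-count-≡-sum universal? (f ∘ ecc G)
    (λ u univ′ → cong f (ecc-universal 2≤n univ′))
    (λ u ¬univ → cong f (≤-antisym (ecc-≤2 3≤n univ u) (ecc-nonuniversal-≥2 2≤n ¬univ)))
    (allFin n)
    where 2≤n = ≤-trans (n≤1+n 2) 3≤n

  isMatching-∷ : ∀ {a b M} → adj G a b ≡ true → a ≢ b → a ∉ endpoints M → b ∉ endpoints M →
                 IsMatching G M → IsMatching G ((a , b) ∷ M)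
  isMatching-∷ {a} {b} {M} ab a≢b a∉M b∉M (edges , M!) = (ab ∷ edges) , (¬Any⇒All¬ _ a∉b∷M ∷ ¬Any⇒All¬ _ b∉M ∷ M!)
    where
    a∉b∷M : a ∉ b ∷ endpoints M
    a∉b∷M (here a≡b) = a≢b a≡b
    a∉b∷M (there a∈) = a∉M a∈

  zip-isMatching : ∀ {A B} → (∀ {x} → x ∈ A → Universal x) → Unique A → Unique B → Disjoint A B → IsMatching G (zip A B)
  zip-isMatching {[]}            _    _ _ _ = [] , []
  zip-isMatching {_ ∷ _} {[]}    _    _ _ _ = [] , []
  zip-isMatching {a ∷ A} {b ∷ B} univ (a∉A ∷ A!) (b∉B ∷ B!) A#B =
    isMatching-∷ (univ (here refl) b a≢b) a≢b a∉ b∉ (zip-isMatching (univ ∘ there) A! B! λ (x∈A , x∈B) → A#B (there x∈A , there x∈B))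
    where
    a≢b : a ≢ b
    a≢b refl = A#B (here refl , here refl)
    a∉ : a ∉ endpoints (zip A B)
    a∉ a∈ with ∈-endpoints-zip A B a∈
    ... | inj₁ a∈A = All.lookup a∉A a∈A refl
    ... | inj₂ a∈B = A#B (here refl , there a∈B)
    b∉ : b ∉ endpoints (zip A B)
    b∉ b∈ with ∈-endpoints-zip A B b∈
    ... | inj₁ b∈A = A#B (there b∈A , here refl)
    ... | inj₂ b∈B = All.lookup b∉B b∈B refl

  universal-matching : ∀ {h} → h ≤ length universals → h + h ≤ n → ∃ λ M → IsMatching G M × h ≤ length M
  universal-matching {h} h≤t 2h≤n = zip A B , zip-isMatching A-universal A! B! A#B , h≤|zip|
    where
    A = take h vertices
    B = drop h vertices
    A! = take⁺ h vertices-unique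
    B! = drop⁺ h vertices-unique
    A#B = take-drop-disjoint h vertices-unique
    A-universal : ∀ {x} → x ∈ A → Universal x
    A-universal x∈A = ∈-universals⁻ (∈-take-++ h universals nonuniversals h≤t x∈A)
    h≤|zip| : h ≤ length (zip A B)
    h≤|zip| = begin
      h                 ≤⟨ ⊓-glb (⊓-glb ≤-refl (m+n≤o⇒m≤o h 2h≤n)) (m+n≤o⇒m≤o∸n h 2h≤n) ⟩
      (h ⊓ n) ⊓ (n ∸ h)   ≡⟨ |A|⊓|B| ⟨
      length A ⊓ length B ≡⟨ length-zipWith _,_ A B ⟨
      length (zip A B)    ∎
      where
      open ≤-Reasoning
      |A|⊓|B| : length A ⊓ length B ≡ (h ⊓ n) ⊓ (n ∸ h)
      |A|⊓|B| rewrite length-take h vertices | length-drop h vertices | length-vertices = refl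

  universals-≤-matchingNumber : ∀ {k} → MatchingNumber G k → suc k + suc k ≤ n → length universals ≤ k
  universals-≤-matchingNumber {k} (_ , maximal) size with suc k ≤? length universals
  ... | no  k≮t = s≤s⁻¹ (≰⇒> k≮t)
  ... | yes k<t with universal-matching k<t size
  ...   | M , M-matching , k<|M| = contradiction (maximal M M-matching) (<⇒≱ k<|M|)

  edge-and-universal-matching : ∀ {h a b} → h ≤ length universals → 2 + h ≤ length nonuniversals →
                                ¬ Universal a → ¬ Universal b → adj G a b ≡ true →
                                ∃ λ M → IsMatching G M × suc h ≤ length M
  edge-and-universal-matching {h} {a} {b} h≤t 2+h≤|N| ¬univ-a ¬univ-b ab = M , M-matching , s≤s h≤|zip|
    where
    B₁ = filter (¬? ∘ (_≟ a)) nonuniversals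
    B  = filter (¬? ∘ (_≟ b)) B₁
    B₁! = filter⁺ (¬? ∘ (_≟ a)) nonuniversals-unique
    B!  = filter⁺ (¬? ∘ (_≟ b)) B₁!
    ∈B⁻ : ∀ {x} → x ∈ B → ¬ Universal x × x ≢ a × x ≢ b
    ∈B⁻ x∈B with ∈-filter⁻ (¬? ∘ (_≟ b)) {xs = B₁} x∈B
    ... | x∈B₁ , x≢b with ∈-filter⁻ (¬? ∘ (_≟ a)) {xs = nonuniversals} x∈B₁
    ...   | x∈N , x≢a = ∈-nonuniversals⁻ x∈N , x≢a , x≢b
    h≤|B| : h ≤ length B
    h≤|B| = s≤s⁻¹ (s≤s⁻¹ (≤-trans 2+h≤|N| (≤-trans (length-remove a nonuniversals-unique) (s≤s (length-remove b B₁!)))))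
    h≤|zip| : h ≤ length (zip universals B)
    h≤|zip| = ≤-trans (⊓-glb h≤t h≤|B|) (≤-reflexive (sym (length-zipWith _,_ universals B)))
    a≢b : a ≢ b
    a≢b refl = contradiction (trans (sym ab) (irrefl G a)) λ ()
    a∉ : a ∉ endpoints (zip universals B)
    a∉ a∈ with ∈-endpoints-zip universals B a∈
    ... | inj₁ a∈U = ¬univ-a (∈-universals⁻ a∈U)
    ... | inj₂ a∈B = proj₁ (proj₂ (∈B⁻ a∈B)) refl
    b∉ : b ∉ endpoints (zip universals B)
    b∉ b∈ with ∈-endpoints-zip universals B b∈
    ... | inj₁ b∈U = ¬univ-b (∈-universals⁻ b∈U)
    ... | inj₂ b∈B = proj₂ (proj₂ (∈B⁻ b∈B)) refl
    M = (a , b) ∷ zip universals B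
    M-matching : IsMatching G M
    M-matching = isMatching-∷ ab a≢b a∉ b∉ (zip-isMatching ∈-universals⁻ universals-unique B!
      λ (x∈U , x∈B) → proj₁ (∈B⁻ x∈B) (∈-universals⁻ x∈U))

  2+k≤nonuniversals : ∀ {k} → suc k + suc k ≤ n → length universals ≡ k → 2 + k ≤ length nonuniversals
  2+k≤nonuniversals {k} size t≡k = +-cancelˡ-≤ k _ _ (begin
    k + (2 + k)                              ≡⟨ +-suc k (suc k) ⟩
    suc k + suc k                            ≤⟨ size ⟩
    n                                        ≡⟨ length-universals+nonuniversals ⟨
    length universals + length nonuniversals ≡⟨ cong (_+ length nonuniversals) t≡k ⟩
    k + length nonuniversals                 ∎)
    where open ≤-Reasoning

  nonuniversals-independent : ∀ {k} → MatchingNumber G k → suc k + suc k ≤ n → length universals ≡ k →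
                              ∀ {a b} → ¬ Universal a → ¬ Universal b → adj G a b ≡ false
  nonuniversals-independent (_ , maximal) size t≡k {a} {b} ¬univ-a ¬univ-b with adj G a b in ab
  ... | false = refl
  ... | true with edge-and-universal-matching (≤-reflexive (sym t≡k)) (2+k≤nonuniversals size t≡k) ¬univ-a ¬univ-b ab
  ...   | M , M-matching , k<|M| = contradiction (maximal M M-matching) (<⇒≱ k<|M|)

  vertices-↔ : Fin n ↔ Fin n
  vertices-↔ = enumeration-↔ vertices-unique ∈-vertices length-vertices

  split-from-universals : ∀ {k} → length universals ≡ k →
                          (∀ {a b} → ¬ Universal a → ¬ Universal b → adj G a b ≡ false) → IsoSplit G k
  split-from-universals {k} t≡k independent = vertices-↔ , adj≡splitAdj
    where
    open Inverse vertices-↔ using (to)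
    to-injective = Injection.injective (↔⇒↣ vertices-↔)
    to-universal : ∀ i → toℕ i < k → Universal (to i)
    to-universal i i<k = ∈-universals⁻ (lookup-∈-++ˡ universals nonuniversals _
      (subst₂ _<_ (sym (toℕ-cast _ i)) (sym t≡k) i<k))
    to-nonuniversal : ∀ i → k ≤ toℕ i → ¬ Universal (to i)
    to-nonuniversal i k≤i = ∈-nonuniversals⁻ (lookup-∈-++ʳ universals nonuniversals _
      (subst₂ _≤_ (sym t≡k) (sym (toℕ-cast _ i)) k≤i))
    adj≡splitAdj : ∀ i j → adj G (to i) (to j) ≡ splitAdj k i j
    adj≡splitAdj i j with i ≟ j
    ... | yes refl = irrefl G (to i)
    ... | no  i≢j with toℕ i <? k
    ...   | yes i<k = to-universal i i<k (to j) (i≢j ∘ to-injective)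
    ...   | no  i≮k with toℕ j <? k
    ...     | yes j<k = trans (adj-sym G (to i) (to j)) (to-universal j j<k (to i) (i≢j ∘ sym ∘ to-injective))
    ...     | no  j≮k = independent (to-nonuniversal i (≮⇒≥ i≮k)) (to-nonuniversal j (≮⇒≥ j≮k))

  split⇒k≤universals : ∀ {k} → k ≤ n → IsoSplit G k → k ≤ length universals
  split⇒k≤universals {k} k≤n (π , adj≡splitAdj) =
    injection-into-list-≤ clique clique-injective λ i → ∈-filter⁺ universal? (∈-allFin (clique i)) (clique-universal i)
    where
    open Inverse π using (to; from; strictlyInverseˡ)
    clique : Fin k → Fin n
    clique i = to (inject≤ i k≤n)
    clique-injective : Injective _≡_ _≡_ clique
    clique-injective = inject≤-injective k≤n k≤n _ _ ∘ Injection.injective (↔⇒↣ π)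
    clique-universal : ∀ i → Universal (clique i)
    clique-universal i v clique≢v = begin
      adj G (clique i) v             ≡⟨ cong (adj G (clique i)) (strictlyInverseˡ v) ⟨
      adj G (clique i) (to (from v)) ≡⟨ adj≡splitAdj (inject≤ i k≤n) (from v) ⟩
      splitAdj k (inject≤ i k≤n) (from v)
        ≡⟨ splitAdj-clique k (λ i≡ → clique≢v (trans (cong to i≡) (strictlyInverseˡ v)))
                               (subst (_< k) (sym (toℕ-inject≤ i k≤n)) (toℕ<n i)) ⟩
      true                           ∎
      where open ≡-Reasoning

shortfall : ∀ {N S x y} → y ≤ N → N ≤ S + x → x ≤ y → (x ≡ y → S + x ≡ N) → N ∸ y ≤ S × (S ≡ N ∸ y ⇔ x ≡ y)
shortfall {N} {S} {x} {y} y≤N N≤S+x x≤y tight =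
  ≤-trans (∸-monoʳ-≤ N x≤y) (m≤n+o⇒m∸n≤o N x (≤-trans N≤S+x (≤-reflexive (+-comm S x)))) ,
  mk⇔ (λ S≡N∸y → ≤-antisym x≤y (+-cancelˡ-≤ (N ∸ y) y x (begin
        N ∸ y + y ≡⟨ m∸n+n≡m y≤N ⟩
        N         ≤⟨ N≤S+x ⟩
        S + x     ≡⟨ cong (_+ x) S≡N∸y ⟩
        N ∸ y + x ∎)))
      (λ x≡y → trans (sym (m+n∸n≡m S y)) (cong (_∸ y) (trans (cong (λ z → S + z) (sym x≡y)) (tight x≡y))))
  where open ≤-Reasoning

2[t+t′]≡t+2t′+t : ∀ t t′ → 2 * (t + t′) ≡ (1 * t + 2 * t′) + t
2[t+t′]≡t+2t′+t = solve-∀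

4[t+t′]≡t+4t′+3t : ∀ t t′ → 4 * (t + t′) ≡ (1 * t + 4 * t′) + 3 * t
4[t+t′]≡t+4t′+3t = solve-∀

module EccentricityBounds {n k : ℕ} (G : Graph n) (matching : MatchingNumber G k) (1≤k : 1 ≤ k)
                          (size : suc k + suc k ≤ n) where

  k≤n : k ≤ n
  k≤n = ≤-trans (n≤1+n k) (≤-trans (m≤m+n (suc k) (suc k)) size)

  private
    t t′ : ℕ
    t  = length (universals G)
    t′ = length (nonuniversals G)

    3≤n : 3 ≤ n
    3≤n = ≤-trans (s≤s (s≤s 1≤k)) (≤-trans (s≤s (m≤n+m (suc k) k)) size)

    2≤n : 2 ≤ n
    2≤n = ≤-trans (n≤1+n 2) 3≤n

    t+t′≡n : t + t′ ≡ n
    t+t′≡n = length-universals+nonuniversals G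

    t≤k : t ≤ k
    t≤k = universals-≤-matchingNumber G matching size

    t≡k⇔split : t ≡ k ⇔ IsoSplit G k
    t≡k⇔split = mk⇔ (λ t≡k → split-from-universals G t≡k (nonuniversals-independent G matching size t≡k))
                    (λ split → ≤-antisym t≤k (split⇒k≤universals G k≤n split))

    universal-exists : t ≡ k → ∃ (Universal G)
    universal-exists t≡k = lookup (universals G) first , ∈-universals⁻ G (∈-lookup first)
      where first = fromℕ< (subst (0 <_) (sym t≡k) 1≤k)

  sum-ecc-shortfall : 2 * n ∸ k ≤ sum (map (ecc G) (allFin n)) × (sum (map (ecc G) (allFin n)) ≡ 2 * n ∸ k ⇔ IsoSplit G k)
  sum-ecc-shortfall = Product.map₂ (λ S≡⇔t≡k → ⇔.trans S≡⇔t≡k t≡k⇔split)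
    (shortfall (≤-trans k≤n (m≤m+n n _)) lower t≤k exact)
    where
    lower : 2 * n ≤ sum (map (ecc G) (allFin n)) + t
    lower = begin
      2 * n                    ≡⟨ cong (2 *_) t+t′≡n ⟨
      2 * (t + t′)             ≡⟨ 2[t+t′]≡t+2t′+t t t′ ⟩
      (1 * t + 2 * t′) + t     ≤⟨ +-monoˡ-≤ t (sum-f∘ecc-≥ G 2≤n id id) ⟩
      sum (map (ecc G) (allFin n)) + t ∎
      where open ≤-Reasoning
    exact : t ≡ k → sum (map (ecc G) (allFin n)) + t ≡ 2 * n
    exact t≡k = begin
      sum (map (ecc G) (allFin n)) + t ≡⟨ cong (_+ t) (sum-f∘ecc-≡ G 3≤n (proj₂ (universal-exists t≡k)) id) ⟨
      (1 * t + 2 * t′) + t     ≡⟨ 2[t+t′]≡t+2t′+t t t′ ⟨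
      2 * (t + t′)             ≡⟨ cong (2 *_) t+t′≡n ⟩
      2 * n                    ∎
      where open ≡-Reasoning

  sum-ecc²-shortfall : 4 * n ∸ 3 * k ≤ σ₁ G × (σ₁ G ≡ 4 * n ∸ 3 * k ⇔ IsoSplit G k)
  sum-ecc²-shortfall = Product.map₂ (λ S≡⇔3t≡3k → ⇔.trans S≡⇔3t≡3k (⇔.trans 3t≡3k⇔t≡k t≡k⇔split))
    (shortfall (*-mono-≤ (n≤1+n 3) k≤n) lower (*-monoʳ-≤ 3 t≤k) (exact ∘ *-cancelˡ-≡ t k 3))
    where
    square : ℕ → ℕ
    square e = e * e
    3t≡3k⇔t≡k : 3 * t ≡ 3 * k ⇔ t ≡ k
    3t≡3k⇔t≡k = mk⇔ (*-cancelˡ-≡ t k 3) (cong (3 *_))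
    lower : 4 * n ≤ σ₁ G + 3 * t
    lower = begin
      4 * n                    ≡⟨ cong (4 *_) t+t′≡n ⟨
      4 * (t + t′)             ≡⟨ 4[t+t′]≡t+4t′+3t t t′ ⟩
      (1 * t + 4 * t′) + 3 * t ≤⟨ +-monoˡ-≤ (3 * t) (sum-f∘ecc-≥ G 2≤n square (λ a≤b → *-mono-≤ a≤b a≤b)) ⟩
      σ₁ G + 3 * t             ∎
      where open ≤-Reasoning
    exact : t ≡ k → σ₁ G + 3 * t ≡ 4 * n
    exact t≡k = begin
      σ₁ G + 3 * t             ≡⟨ cong (_+ 3 * t) (sum-f∘ecc-≡ G 3≤n (proj₂ (universal-exists t≡k)) square) ⟨
      (1 * t + 4 * t′) + 3 * t ≡⟨ 4[t+t′]≡t+4t′+3t t t′ ⟨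
      4 * (t + t′)             ≡⟨ cong (4 *_) t+t′≡n ⟩
      4 * n                    ∎
      where open ≡-Reasoning

module _ (m : ℕ) where

  private
    _/n : ℕ → ℚ
    a /n = + a ℚ./ suc m

    /n≃ : ∀ a → ℚ.toℚᵘ (a /n) ≃ᵘ mkℚᵘ (+ a) m
    /n≃ a = ℚ.toℚᵘ-fromℚᵘ (mkℚᵘ (+ a) m)

  twoMinus≡2n∸k/n : ∀ k → k ≤ 2 * suc m → twoMinus (suc m) k ≡ + (2 * suc m ∸ k) ℚ./ suc m
  twoMinus≡2n∸k/n k k≤2n = ℚ.toℚᵘ-injective (ℚᵘ.≃-trans to-ℚᵘ (ℚᵘ.≃-trans (*≡* cross) (ℚᵘ.≃-sym (/n≃ (2 * suc m ∸ k)))))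
    where
    to-ℚᵘ : ℚ.toℚᵘ (twoMinus (suc m) k) ≃ᵘ mkℚᵘ (+ 2) 0 ℚᵘ.+ ℚᵘ.- mkℚᵘ (+ k) m
    to-ℚᵘ = ℚᵘ.≃-trans (ℚ.toℚᵘ-homo-+ (1ℚ ℚ.+ 1ℚ) (ℚ.- (k /n)))
              (ℚᵘ.+-cong (ℚᵘ.≃-refl {mkℚᵘ (+ 2) 0}) (ℚᵘ.≃-trans (ℚ.toℚᵘ-homo‿- (k /n)) (ℚᵘ.-‿cong (/n≃ k))))
    2n-k : + 2 ℤ.* + suc m ℤ.+ ℤ.- + k ≡ + (2 * suc m ∸ k)
    2n-k = trans (cong (ℤ._+ ℤ.- + k) (sym (ℤ.pos-* 2 (suc m)))) (trans (ℤ.m-n≡m⊖n (2 * suc m) k) (ℤ.⊖-≥ k≤2n))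
    cross : (+ 2 ℤ.* + suc m ℤ.+ ℤ.- + k ℤ.* + 1) ℤ.* + suc m ≡ + (2 * suc m ∸ k) ℤ.* + (1 * suc m)
    cross = begin
      (+ 2 ℤ.* + suc m ℤ.+ ℤ.- + k ℤ.* + 1) ℤ.* + suc m ≡⟨ ignore-*1 (+ suc m) (+ k) ⟩
      (+ 2 ℤ.* + suc m ℤ.+ ℤ.- + k) ℤ.* + suc m         ≡⟨ cong₂ ℤ._*_ 2n-k (cong +_ (sym (*-identityˡ (suc m)))) ⟩
      + (2 * suc m ∸ k) ℤ.* + (1 * suc m)               ∎
      where
      open ≡-Reasoning
      ignore-*1 : ∀ N K → (+ 2 ℤ.* N ℤ.+ ℤ.- K ℤ.* + 1) ℤ.* N ≡ (+ 2 ℤ.* N ℤ.+ ℤ.- K) ℤ.* N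
      ignore-*1 = solve-∀ℤ

  /-mono-≤ : ∀ {a b} → a ≤ b → a /n ≤ℚ b /n
  /-mono-≤ {a} {b} a≤b = ℚ.toℚᵘ-cancel-≤ (ℚᵘ.≤-respˡ-≃ (ℚᵘ.≃-sym (/n≃ a)) (ℚᵘ.≤-respʳ-≃ (ℚᵘ.≃-sym (/n≃ b))
    (*≤* (subst₂ ℤ._≤_ (ℤ.pos-* a (suc m)) (ℤ.pos-* b (suc m)) (ℤ.+≤+ (*-monoˡ-≤ (suc m) a≤b))))))

  /-injective : ∀ {a b} → a /n ≡ b /n → a ≡ b
  /-injective {a} {b} eq with ℚ./-injective-≃ (mkℚᵘ (+ a) m) (mkℚᵘ (+ b) m) eq
  ... | *≡* cross = *-cancelʳ-≡ a b (suc m) (ℤ.+-injective (trans (ℤ.pos-* a (suc m)) (trans cross (sym (ℤ.pos-* b (suc m))))))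

  shortfall-ℚ : ∀ {a b} {P : Set} → a ≤ b × (b ≡ a ⇔ P) → a /n ≤ℚ b /n × (b /n ≡ a /n ⇔ P)
  shortfall-ℚ (a≤b , b≡a⇔P) = /-mono-≤ a≤b , mk⇔ (Equivalence.to b≡a⇔P ∘ /-injective) (cong _/n ∘ Equivalence.from b≡a⇔P)

<n/2⇒[1+k]+[1+k]≤n : ∀ {k n} → k < n / 2 → suc k + suc k ≤ n
<n/2⇒[1+k]+[1+k]≤n {k} {n} k<n/2 = begin
  suc k + suc k ≡⟨ cong (λ x → suc k + x) (+-identityʳ (suc k)) ⟨
  2 * suc k     ≤⟨ *-monoʳ-≤ 2 k<n/2 ⟩
  2 * (n / 2)   ≡⟨ *-comm 2 (n / 2) ⟩
  n / 2 * 2     ≤⟨ m/n*n≤m n 2 ⟩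
  n             ∎
  where open ≤-Reasoning

proposition5p2 : ∀ (n k : ℕ) (G : Graph n) → Connected G → MatchingNumber G k →
                 2 ≤ k → k < n / 2 →
                 (twoMinus n k ≤ℚ σ₀ G × (σ₀ G ≡ twoMinus n k ⇔ IsoSplit G k))
                 × (4 * n ∸ 3 * k ≤ σ₁ G × (σ₁ G ≡ 4 * n ∸ 3 * k ⇔ IsoSplit G k))
proposition5p2 zero    k G _ _ _ ()
proposition5p2 (suc m) k G _ matching 2≤k k<n/2 =
  subst (λ q → q ≤ℚ σ₀ G × (σ₀ G ≡ q ⇔ IsoSplit G k)) (sym (twoMinus≡2n∸k/n m k k≤2n)) (shortfall-ℚ m sum-ecc-shortfall) ,
  sum-ecc²-shortfall
  where
  open EccentricityBounds G matching (≤-trans (n≤1+n 1) 2≤k) (<n/2⇒[1+k]+[1+k]≤n k<n/2)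
  k≤2n : k ≤ 2 * suc m
  k≤2n = ≤-trans k≤n (m≤m+n (suc m) _)
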